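{- Let $D=(E,\mathcal{F})$ be a set system and let $a,b\in E$ with $a\neq b$. Let $\widetilde{D'}_{ab}$ be the set system obtained from $D$ by first exchanging handle ends of $a$ and $b$ and then handle sliding $a$ over $b$, i.e. $\widetilde{D'}_{ab}=\widetilde{(D'_{ab})}_{ab}$, and let $\widetilde{D}'_{ab}=(\widetilde{D}_{ab})'_{ab}$ be obtained by first handle sliding $a$ over $b$ and then exchanging handle ends of $a$ and $b$. Then the feasible sets of $\widetilde{D'}_{ab}$ are $$\widetilde{\mathcal{F}'}_{ab}=\mathcal{F}\,\triangle\, \{F\cup \{a,b\}: F\in \mathcal{F},\ F\subseteq E\setminus\{a,b\}\}\,\triangle\, \{F\cup \{a\}: F\cup \{b\}\in \mathcal{F},\ F\subseteq E\setminus\{a,b\}\},$$ and moreover $\widetilde{D}'_{ab}=\widetilde{D'}_{ab}$.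
   Context: A set system $D=(E,\mathcal{F})$ is a finite set $E$ (the ground set) together with a nonempty collection $\mathcal{F}\subseteq 2^E$ of subsets (the feasible sets). $X\triangle Y=(X\cup Y)\setminus(X\cap Y)$ denotes symmetric difference. For distinct $a,b\in E$: the handle sliding of $a$ over $b$ is the set system $\widetilde{D}_{ab}=(E,\widetilde{\mathcal{F}}_{ab})$ with $\widetilde{\mathcal{F}}_{ab}=\mathcal{F}\triangle\{F\cup\{a\}: F\cup\{b\}\in\mathcal{F},\ F\subseteq E\setminus\{a,b\}\}$; the exchange of handle ends of $a$ and $b$ is the set system $D'_{ab}=(E,\mathcal{F}'_{ab})$ with $\mathcal{F}'_{ab}=\mathcal{F}\triangle\{F\cup\{a,b\}: F\in\mathcal{F},\ F\subseteq E\setminus\{a,b\}\}$. -}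

module Defs where

open import Data.Bool using (Bool; true; false; _xor_; _∧_; not)
open import Data.Fin using (Fin)
open import Data.Fin.Subset using (Subset; inside; outside)
open import Data.Vec using (lookup; _[_]≔_)
open import Data.Product using (∃)
open import Relation.Binary.PropositionalEquality using (_≡_)

-- Ground set E = Fin n; a subset X ⊆ E is a Subset n (Vec Bool n).
-- A collection 𝓕 ⊆ 2^E is given by its (Boolean) characteristic function.
Family : ∀ {n} → Set
Family {n} = Subset n → Bool

mem : ∀ {n} → Fin n → Subset n → Bool
mem a X = lookup X a

Nonempty : ∀ {n} → Family {n} → Set
Nonempty 𝓕 = ∃ λ X → 𝓕 X ≡ true

_△_ : ∀ {n} → Family {n} → Family {n} → Family {n}
(𝓐 △ 𝓑) X = 𝓐 X xor 𝓑 X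
infixl 6 _△_

-- { F ∪ {a} : F ∪ {b} ∈ 𝓕, F ⊆ E \ {a,b} }
-- X is of the form F ∪ {a} with F ⊆ E\{a,b} iff a ∈ X, b ∉ X, and then F = X \ {a},
-- so F ∪ {b} = (X with a removed and b added).
slideSet : ∀ {n} → Fin n → Fin n → Family {n} → Family {n}
slideSet a b 𝓕 X = mem a X ∧ not (mem b X) ∧ 𝓕 ((X [ a ]≔ outside) [ b ]≔ inside)

-- { F ∪ {a,b} : F ∈ 𝓕, F ⊆ E \ {a,b} }
-- X is of this form iff a, b ∈ X, and then F = X \ {a,b}.
exchSet : ∀ {n} → Fin n → Fin n → Family {n} → Family {n}
exchSet a b 𝓕 X = mem a X ∧ mem b X ∧ 𝓕 ((X [ a ]≔ outside) [ b ]≔ outside)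

slide : ∀ {n} → Fin n → Fin n → Family {n} → Family {n}
slide a b 𝓕 = 𝓕 △ slideSet a b 𝓕

exch : ∀ {n} → Fin n → Fin n → Family {n} → Family {n}
exch a b 𝓕 = 𝓕 △ exchSet a b 𝓕

_≗F_ : ∀ {n} → Family {n} → Family {n} → Set
𝓐 ≗F 𝓑 = ∀ X → 𝓐 X ≡ 𝓑 X
infix 4 _≗F_

-- Handle sliding only consults 𝓕 at sets avoiding a, and exchanging handle ends only
-- changes 𝓕 at sets containing a; symmetrically, exchanging handle ends only consults
-- sets avoiding a, where sliding changes nothing.  So each operation sees the same
-- correction family whether or not the other one has been applied first, and the two
-- symmetric differences commute.
module Submission where

open import Defs
open import Data.Nat using (ℕ)
open import Data.Fin using (Fin)
open import Data.Fin.Subset using (Subset; inside; outside)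
open import Data.Bool using (false; _xor_; _∧_; not)
open import Data.Bool.Properties using (xor-assoc; xor-comm; xor-identityʳ)
open import Data.Vec using (_[_]≔_)
open import Data.Vec.Properties using (lookup∘updateAt; lookup∘updateAt′)
open import Data.Product using (_×_; _,_)
open import Relation.Binary.PropositionalEquality
  using (_≡_; _≢_; refl; trans; cong; sym; module ≡-Reasoning)

private
  variable
    n : ℕ

xor-swapʳ : ∀ p q r → (p xor q) xor r ≡ (p xor r) xor q
xor-swapʳ p q r = begin
  (p xor q) xor r  ≡⟨ xor-assoc p q r ⟩
  p xor (q xor r)  ≡⟨ cong (p xor_) (xor-comm q r) ⟩
  p xor (r xor q)  ≡⟨ sym (xor-assoc p r q) ⟩
  (p xor r) xor q  ∎
  where open ≡-Reasoning

mem-≔-≔ : (a b : Fin n) → a ≢ b → ∀ (X : Subset n) u v →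
          mem a ((X [ a ]≔ u) [ b ]≔ v) ≡ u
mem-≔-≔ a b a≢b X u v =
  trans (lookup∘updateAt′ a b a≢b (X [ a ]≔ u)) (lookup∘updateAt a X)

slideSet-outside : (a b : Fin n) (𝓕 : Family) → ∀ X → mem a X ≡ false →
                   slideSet a b 𝓕 X ≡ false
slideSet-outside a b 𝓕 X a∉X rewrite a∉X = refl

exchSet-outside : (a b : Fin n) (𝓕 : Family) → ∀ X → mem a X ≡ false →
                  exchSet a b 𝓕 X ≡ false
exchSet-outside a b 𝓕 X a∉X rewrite a∉X = refl

slide-outside : (a b : Fin n) (𝓕 : Family) → ∀ X → mem a X ≡ false →
                slide a b 𝓕 X ≡ 𝓕 X
slide-outside a b 𝓕 X a∉X =
  trans (cong (𝓕 X xor_) (slideSet-outside a b 𝓕 X a∉X)) (xor-identityʳ (𝓕 X))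

exch-outside : (a b : Fin n) (𝓕 : Family) → ∀ X → mem a X ≡ false →
               exch a b 𝓕 X ≡ 𝓕 X
exch-outside a b 𝓕 X a∉X =
  trans (cong (𝓕 X xor_) (exchSet-outside a b 𝓕 X a∉X)) (xor-identityʳ (𝓕 X))

slideSet-exch : (a b : Fin n) → a ≢ b → (𝓕 : Family) →
                slideSet a b (exch a b 𝓕) ≗F slideSet a b 𝓕
slideSet-exch a b a≢b 𝓕 X =
  cong (λ t → mem a X ∧ not (mem b X) ∧ t)
       (exch-outside a b 𝓕 _ (mem-≔-≔ a b a≢b X outside inside))

exchSet-slide : (a b : Fin n) → a ≢ b → (𝓕 : Family) →
                exchSet a b (slide a b 𝓕) ≗F exchSet a b 𝓕
exchSet-slide a b a≢b 𝓕 X =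
  cong (λ t → mem a X ∧ mem b X ∧ t)
       (slide-outside a b 𝓕 _ (mem-≔-≔ a b a≢b X outside outside))

slide-exch : (a b : Fin n) → a ≢ b → (𝓕 : Family) →
             slide a b (exch a b 𝓕) ≗F 𝓕 △ exchSet a b 𝓕 △ slideSet a b 𝓕
slide-exch a b a≢b 𝓕 X = cong (exch a b 𝓕 X xor_) (slideSet-exch a b a≢b 𝓕 X)

exch-slide : (a b : Fin n) → a ≢ b → (𝓕 : Family) →
             exch a b (slide a b 𝓕) ≗F 𝓕 △ exchSet a b 𝓕 △ slideSet a b 𝓕
exch-slide a b a≢b 𝓕 X = begin
  (𝓕 X xor slideSet a b 𝓕 X) xor exchSet a b (slide a b 𝓕) X
    ≡⟨ cong (slide a b 𝓕 X xor_) (exchSet-slide a b a≢b 𝓕 X) ⟩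
  (𝓕 X xor slideSet a b 𝓕 X) xor exchSet a b 𝓕 X
    ≡⟨ xor-swapʳ (𝓕 X) (slideSet a b 𝓕 X) (exchSet a b 𝓕 X) ⟩
  (𝓕 X xor exchSet a b 𝓕 X) xor slideSet a b 𝓕 X  ∎
  where open ≡-Reasoning

proposition2p5 : ∀ (n : ℕ) (𝓕 : Family {n}) → Nonempty 𝓕 → (a b : Fin n) → a ≢ b →
    (slide a b (exch a b 𝓕) ≗F 𝓕 △ exchSet a b 𝓕 △ slideSet a b 𝓕)
    × (exch a b (slide a b 𝓕) ≗F slide a b (exch a b 𝓕))
proposition2p5 n 𝓕 _ a b a≢b =
  slide-exch a b a≢b 𝓕 ,
  λ X → trans (exch-slide a b a≢b 𝓕 X) (sym (slide-exch a b a≢b 𝓕 X))
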